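{- Let $\varphi$ be a formula, $\Theta$ a set of formulas, and $c$ an individual constant. Let $p$ be a unary predicate and $z$ a variable, neither occurring in $\varphi$ or $\Theta$. Let $\varphi'$ be the result of replacing all occurrences of $c$ in $\varphi$ by $z$, and let $\psi$ be $\forall z(\varphi'\vee\neg p(z))$. Then $\Theta\cup\{\varphi\}$ and $\Theta\cup\{p(c),\psi\}$ are satisfiable over the same domains.
   Context: "Satisfiable over the same domains" means: for every set $A$, there is a model of the first set with domain $A$ iff there is a model of the second set with domain $A$. -}

module Defs where

open import Level using (0ℓ)
open import Data.Nat using (ℕ; _≟_)
open import Data.List using (List; []; _∷_; _++_)
open import Data.List.Membership.Propositional using (_∉_)
open import Data.Product using (Σ; _×_; _,_)
open import Data.Sum using (_⊎_)
open import Data.Empty using (⊥)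
open import Relation.Nullary using (¬_; yes; no)
open import Relation.Binary.PropositionalEquality using (_≡_)
open import Axiom.ExcludedMiddle using (ExcludedMiddle) public

data Term : Set where
  var : ℕ → Term
  con : ℕ → Term
  fun : ℕ → List Term → Term

data Formula : Set where
  atom : ℕ → List Term → Formula
  _≐_  : Term → Term → Formula
  ⊥'   : Formula
  ¬'_  : Formula → Formula
  _∧'_ : Formula → Formula → Formula
  _∨'_ : Formula → Formula → Formula
  _⇒'_ : Formula → Formula → Formula
  all' : ℕ → Formula → Formula
  ex'  : ℕ → Formula → Formula

mutual
  varsT : Term → List ℕ
  varsT (var x)    = x ∷ []
  varsT (con _)    = []
  varsT (fun _ ts) = varsTs ts

  varsTs : List Term → List ℕ
  varsTs []       = []
  varsTs (t ∷ ts) = varsT t ++ varsTs ts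

vars : Formula → List ℕ
vars (atom _ ts) = varsTs ts
vars (s ≐ t)     = varsT s ++ varsT t
vars ⊥'          = []
vars (¬' φ)      = vars φ
vars (φ ∧' ψ)    = vars φ ++ vars ψ
vars (φ ∨' ψ)    = vars φ ++ vars ψ
vars (φ ⇒' ψ)    = vars φ ++ vars ψ
vars (all' x φ)  = x ∷ vars φ
vars (ex' x φ)   = x ∷ vars φ

preds : Formula → List ℕ
preds (atom P _) = P ∷ []
preds (_ ≐ _)    = []
preds ⊥'         = []
preds (¬' φ)     = preds φ
preds (φ ∧' ψ)   = preds φ ++ preds ψ
preds (φ ∨' ψ)   = preds φ ++ preds ψ
preds (φ ⇒' ψ)   = preds φ ++ preds ψ
preds (all' _ φ) = preds φ
preds (ex' _ φ)  = preds φ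

mutual
  replT : ℕ → ℕ → Term → Term
  replT c z (var x)    = var x
  replT c z (con d) with d ≟ c
  ... | yes _ = var z
  ... | no  _ = con d
  replT c z (fun f ts) = fun f (replTs c z ts)

  replTs : ℕ → ℕ → List Term → List Term
  replTs c z []       = []
  replTs c z (t ∷ ts) = replT c z t ∷ replTs c z ts

repl : ℕ → ℕ → Formula → Formula
repl c z (atom P ts) = atom P (replTs c z ts)
repl c z (s ≐ t)     = replT c z s ≐ replT c z t
repl c z ⊥'          = ⊥'
repl c z (¬' φ)      = ¬' repl c z φ
repl c z (φ ∧' ψ)    = repl c z φ ∧' repl c z ψ
repl c z (φ ∨' ψ)    = repl c z φ ∨' repl c z ψ
repl c z (φ ⇒' ψ)    = repl c z φ ⇒' repl c z ψ
repl c z (all' x φ)  = all' x (repl c z φ)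
repl c z (ex' x φ)   = ex' x (repl c z φ)

record Structure (A : Set) : Set₁ where
  field
    conI : ℕ → A
    funI : ℕ → List A → A
    relI : ℕ → List A → Set

open Structure public

Valuation : Set → Set
Valuation A = ℕ → A

_[_↦_] : {A : Set} → Valuation A → ℕ → A → Valuation A
(v [ x ↦ a ]) y with y ≟ x
... | yes _ = a
... | no  _ = v y

mutual
  evalT : {A : Set} → Structure A → Valuation A → Term → A
  evalT M v (var x)    = v x
  evalT M v (con d)    = conI M d
  evalT M v (fun f ts) = funI M f (evalTs M v ts)

  evalTs : {A : Set} → Structure A → Valuation A → List Term → List A
  evalTs M v []       = []
  evalTs M v (t ∷ ts) = evalT M v t ∷ evalTs M v ts

⟦_⟧ : {A : Set} → Formula → Structure A → Valuation A → Set
⟦ atom P ts ⟧ M v = relI M P (evalTs M v ts)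
⟦ s ≐ t ⟧     M v = evalT M v s ≡ evalT M v t
⟦ ⊥' ⟧        M v = ⊥
⟦ ¬' φ ⟧      M v = ¬ ⟦ φ ⟧ M v
⟦ φ ∧' ψ ⟧    M v = ⟦ φ ⟧ M v × ⟦ ψ ⟧ M v
⟦ φ ∨' ψ ⟧    M v = ⟦ φ ⟧ M v ⊎ ⟦ ψ ⟧ M v
⟦ φ ⇒' ψ ⟧    M v = ⟦ φ ⟧ M v → ⟦ ψ ⟧ M v
⟦ all' x φ ⟧  M v = (a : _) → ⟦ φ ⟧ M (v [ x ↦ a ])
⟦ ex' x φ ⟧   M v = Σ _ λ a → ⟦ φ ⟧ M (v [ x ↦ a ])

FormulaSet : Set₁
FormulaSet = Formula → Set

_∪_ : FormulaSet → FormulaSet → FormulaSet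
(Γ ∪ Δ) χ = Γ χ ⊎ Δ χ

⁅_⁆ : Formula → FormulaSet
⁅ φ ⁆ χ = χ ≡ φ

⁅_,_⁆ : Formula → Formula → FormulaSet
⁅ φ , ψ ⁆ χ = χ ≡ φ ⊎ χ ≡ ψ

ModelOn : (A : Set) → FormulaSet → Set₁
ModelOn A Γ = Σ (Structure A) λ M → Σ (Valuation A) λ v →
                ((χ : Formula) → Γ χ → ⟦ χ ⟧ M v)

SameDomains : FormulaSet → FormulaSet → Set₁
SameDomains Γ Δ = (A : Set) → (ModelOn A Γ → ModelOn A Δ) × (ModelOn A Δ → ModelOn A Γ)

-- Forward: reinterpret p as the singleton {c}.  Since p does not occur in φ or Θ,
-- these stay true; p(c) holds, and ψ holds because at z = c the formula φ' says φ,
-- while at any other point ¬p(z) holds (here excluded middle decides z = c).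
-- Backward: instantiate ψ at z = c; p(c) rules out the second disjunct, and φ' at
-- z = c is φ because z does not occur in φ.

module Submission where

open import Defs
open import Level using (0ℓ)
open import Data.Bool using (if_then_else_)
open import Data.Nat using (ℕ; _≟_)
open import Data.List using (List; []; _∷_)
open import Data.List.Membership.Propositional using (_∉_)
open import Data.List.Membership.Propositional.Properties using (∈-++⁺ˡ; ∈-++⁺ʳ)
open import Data.List.Relation.Unary.Any using (here; there)
open import Data.Product using (Σ; map₂; _,′_)
open import Data.Product.Function.NonDependent.Propositional using (_×-⇔_)
open import Data.Sum using (inj₁; inj₂)
open import Data.Sum.Function.Propositional using (_⊎-⇔_)
open import Data.Empty using (⊥-elim)
open import Function using (_∘_; _⇔_; mk⇔; Equivalence)
open import Function.Construct.Identity using (⇔-id)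
open import Function.Related.TypeIsomorphisms using (→-cong-⇔; ¬-cong-⇔)
open import Relation.Nullary using (yes; no)
open import Relation.Nullary.Decidable using (⌊_⌋)
open import Relation.Binary.PropositionalEquality using (_≡_; _≢_; refl; sym; trans; cong; cong₂)

open Equivalence using (to; from)

Π-cong-⇔ : {A : Set} {P Q : A → Set} → (∀ a → P a ⇔ Q a) → ((a : A) → P a) ⇔ ((a : A) → Q a)
Π-cong-⇔ P⇔Q = mk⇔ (λ f a → to (P⇔Q a) (f a)) (λ g a → from (P⇔Q a) (g a))

Σ-cong-⇔ : {A : Set} {P Q : A → Set} → (∀ a → P a ⇔ Q a) → Σ A P ⇔ Σ A Q
Σ-cong-⇔ P⇔Q = mk⇔ (map₂ λ {a} → to (P⇔Q a)) (map₂ λ {a} → from (P⇔Q a))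

≡-cong-⇔ : {A : Set} {a b c d : A} → a ≡ c → b ≡ d → (a ≡ b) ⇔ (c ≡ d)
≡-cong-⇔ refl refl = ⇔-id _

module _ {A : Set} (v : Valuation A) (x : ℕ) (a : A) where

  update-same : (v [ x ↦ a ]) x ≡ a
  update-same with x ≟ x
  ... | yes _ = refl
  ... | no x≢x = ⊥-elim (x≢x refl)

  update-other : ∀ {y} → y ≢ x → (v [ x ↦ a ]) y ≡ v y
  update-other {y} y≢x with y ≟ x
  ... | yes y≡x = ⊥-elim (y≢x y≡x)
  ... | no _ = refl

_⟨_≔_⟩ : {A : Set} → Structure A → ℕ → (List A → Set) → Structure A
M ⟨ p ≔ P ⟩ = record M { relI = λ q → if ⌊ q ≟ p ⌋ then P else relI M q }

module _ {A : Set} (M : Structure A) (p : ℕ) (P : List A → Set) where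

  relI-⟨≔⟩-same : relI (M ⟨ p ≔ P ⟩) p ≡ P
  relI-⟨≔⟩-same with p ≟ p
  ... | yes _ = refl
  ... | no p≢p = ⊥-elim (p≢p refl)

  relI-⟨≔⟩-other : ∀ {q} → q ≢ p → relI (M ⟨ p ≔ P ⟩) q ≡ relI M q
  relI-⟨≔⟩-other {q} q≢p with q ≟ p
  ... | yes q≡p = ⊥-elim (q≢p q≡p)
  ... | no _ = refl

  mutual
    evalT-⟨≔⟩ : ∀ v t → evalT (M ⟨ p ≔ P ⟩) v t ≡ evalT M v t
    evalT-⟨≔⟩ v (var x)    = refl
    evalT-⟨≔⟩ v (con d)    = refl
    evalT-⟨≔⟩ v (fun f ts) = cong (funI M f) (evalTs-⟨≔⟩ v ts)

    evalTs-⟨≔⟩ : ∀ v ts → evalTs (M ⟨ p ≔ P ⟩) v ts ≡ evalTs M v ts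
    evalTs-⟨≔⟩ v []       = refl
    evalTs-⟨≔⟩ v (t ∷ ts) = cong₂ _∷_ (evalT-⟨≔⟩ v t) (evalTs-⟨≔⟩ v ts)

  ⟦⟧-⟨≔⟩-fresh : ∀ φ → p ∉ preds φ → ∀ v → ⟦ φ ⟧ (M ⟨ p ≔ P ⟩) v ⇔ ⟦ φ ⟧ M v
  ⟦⟧-⟨≔⟩-fresh (atom q ts) p∉ v
    rewrite relI-⟨≔⟩-other (p∉ ∘ here ∘ sym) | evalTs-⟨≔⟩ v ts = ⇔-id _
  ⟦⟧-⟨≔⟩-fresh (s ≐ t)    p∉ v = ≡-cong-⇔ (evalT-⟨≔⟩ v s) (evalT-⟨≔⟩ v t)
  ⟦⟧-⟨≔⟩-fresh ⊥'         p∉ v = ⇔-id _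
  ⟦⟧-⟨≔⟩-fresh (¬' φ)     p∉ v = ¬-cong-⇔ (⟦⟧-⟨≔⟩-fresh φ p∉ v)
  ⟦⟧-⟨≔⟩-fresh (φ ∧' ψ)   p∉ v =
    ⟦⟧-⟨≔⟩-fresh φ (p∉ ∘ ∈-++⁺ˡ) v ×-⇔ ⟦⟧-⟨≔⟩-fresh ψ (p∉ ∘ ∈-++⁺ʳ (preds φ)) v
  ⟦⟧-⟨≔⟩-fresh (φ ∨' ψ)   p∉ v =
    ⟦⟧-⟨≔⟩-fresh φ (p∉ ∘ ∈-++⁺ˡ) v ⊎-⇔ ⟦⟧-⟨≔⟩-fresh ψ (p∉ ∘ ∈-++⁺ʳ (preds φ)) v
  ⟦⟧-⟨≔⟩-fresh (φ ⇒' ψ)   p∉ v =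
    →-cong-⇔ (⟦⟧-⟨≔⟩-fresh φ (p∉ ∘ ∈-++⁺ˡ) v) (⟦⟧-⟨≔⟩-fresh ψ (p∉ ∘ ∈-++⁺ʳ (preds φ)) v)
  ⟦⟧-⟨≔⟩-fresh (all' x φ) p∉ v = Π-cong-⇔ λ a → ⟦⟧-⟨≔⟩-fresh φ p∉ (v [ x ↦ a ])
  ⟦⟧-⟨≔⟩-fresh (ex' x φ)  p∉ v = Σ-cong-⇔ λ a → ⟦⟧-⟨≔⟩-fresh φ p∉ (v [ x ↦ a ])

module _ {A : Set} (M : Structure A) (c z : ℕ) where

  AgreeOff : Valuation A → Valuation A → Set
  AgreeOff v w = ∀ {y} → y ≢ z → v y ≡ w y

  AgreeOff-update : ∀ {v w} → AgreeOff v w → ∀ x a → AgreeOff (v [ x ↦ a ]) (w [ x ↦ a ])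
  AgreeOff-update v≈w x a {y} y≢z with y ≟ x
  ... | yes _ = refl
  ... | no _ = v≈w y≢z

  module _ {v w : Valuation A} (v≈w : AgreeOff v w) (wz≡c : w z ≡ conI M c) where
    mutual
      evalT-replT : ∀ t → z ∉ varsT t → evalT M w (replT c z t) ≡ evalT M v t
      evalT-replT (var x) z∉ = sym (v≈w (z∉ ∘ here ∘ sym))
      evalT-replT (con d) z∉ with d ≟ c
      ... | yes refl = wz≡c
      ... | no _ = refl
      evalT-replT (fun f ts) z∉ = cong (funI M f) (evalTs-replTs ts z∉)

      evalTs-replTs : ∀ ts → z ∉ varsTs ts → evalTs M w (replTs c z ts) ≡ evalTs M v ts
      evalTs-replTs []       z∉ = refl
      evalTs-replTs (t ∷ ts) z∉ =
        cong₂ _∷_ (evalT-replT t (z∉ ∘ ∈-++⁺ˡ)) (evalTs-replTs ts (z∉ ∘ ∈-++⁺ʳ (varsT t)))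

  ⟦repl⟧⇔ : ∀ φ → z ∉ vars φ → ∀ {v w} → AgreeOff v w → w z ≡ conI M c →
            ⟦ repl c z φ ⟧ M w ⇔ ⟦ φ ⟧ M v
  ⟦repl⟧⇔ (atom q ts) z∉ v≈w wz≡c rewrite evalTs-replTs v≈w wz≡c ts z∉ = ⇔-id _
  ⟦repl⟧⇔ (s ≐ t) z∉ v≈w wz≡c =
    ≡-cong-⇔ (evalT-replT v≈w wz≡c s (z∉ ∘ ∈-++⁺ˡ)) (evalT-replT v≈w wz≡c t (z∉ ∘ ∈-++⁺ʳ (varsT s)))
  ⟦repl⟧⇔ ⊥' z∉ v≈w wz≡c = ⇔-id _
  ⟦repl⟧⇔ (¬' φ) z∉ v≈w wz≡c = ¬-cong-⇔ (⟦repl⟧⇔ φ z∉ v≈w wz≡c)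
  ⟦repl⟧⇔ (φ ∧' ψ) z∉ v≈w wz≡c =
    ⟦repl⟧⇔ φ (z∉ ∘ ∈-++⁺ˡ) v≈w wz≡c ×-⇔ ⟦repl⟧⇔ ψ (z∉ ∘ ∈-++⁺ʳ (vars φ)) v≈w wz≡c
  ⟦repl⟧⇔ (φ ∨' ψ) z∉ v≈w wz≡c =
    ⟦repl⟧⇔ φ (z∉ ∘ ∈-++⁺ˡ) v≈w wz≡c ⊎-⇔ ⟦repl⟧⇔ ψ (z∉ ∘ ∈-++⁺ʳ (vars φ)) v≈w wz≡c
  ⟦repl⟧⇔ (φ ⇒' ψ) z∉ v≈w wz≡c =
    →-cong-⇔ (⟦repl⟧⇔ φ (z∉ ∘ ∈-++⁺ˡ) v≈w wz≡c) (⟦repl⟧⇔ ψ (z∉ ∘ ∈-++⁺ʳ (vars φ)) v≈w wz≡c)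
  ⟦repl⟧⇔ (all' x φ) z∉ {w = w} v≈w wz≡c = Π-cong-⇔ λ a →
    ⟦repl⟧⇔ φ (z∉ ∘ there) (AgreeOff-update v≈w x a) (trans (update-other w x a (z∉ ∘ here)) wz≡c)
  ⟦repl⟧⇔ (ex' x φ) z∉ {w = w} v≈w wz≡c = Σ-cong-⇔ λ a →
    ⟦repl⟧⇔ φ (z∉ ∘ there) (AgreeOff-update v≈w x a) (trans (update-other w x a (z∉ ∘ here)) wz≡c)

  ⟦repl⟧-at-con : ∀ φ → z ∉ vars φ → ∀ v → ⟦ repl c z φ ⟧ M (v [ z ↦ conI M c ]) ⇔ ⟦ φ ⟧ M v
  ⟦repl⟧-at-con φ z∉ v =
    ⟦repl⟧⇔ φ z∉ (sym ∘ update-other v z (conI M c)) (update-same v z (conI M c))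

module _ (φ : Formula) (Θ : FormulaSet) (c p z : ℕ) where

  ψ : Formula
  ψ = all' z (repl c z φ ∨' (¬' atom p (var z ∷ [])))

  Γ Δ : FormulaSet
  Γ = Θ ∪ ⁅ φ ⁆
  Δ = Θ ∪ ⁅ atom p (con c ∷ []) , ψ ⁆

  -- Not opened at top level, where it makes ⁅_,_⁆ ambiguous.
  open import Data.Product using (_,_)

  model-with-witness-predicate : ExcludedMiddle 0ℓ →
    p ∉ preds φ → ((θ : Formula) → Θ θ → p ∉ preds θ) → z ∉ vars φ →
    ∀ {A} → ModelOn A Γ → ModelOn A Δ
  model-with-witness-predicate em p∉φ p∉Θ z∉φ (M , v , M⊨) = M⁺ , v , M⁺⊨
    where
    M⁺ : Structure _
    M⁺ = M ⟨ p ≔ _≡ conI M c ∷ [] ⟩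

    M⁺⊨φ : ⟦ φ ⟧ M⁺ v
    M⁺⊨φ = from (⟦⟧-⟨≔⟩-fresh M p _ φ p∉φ v) (M⊨ φ (inj₂ refl))

    M⁺⊨ψ-at : ∀ a → ⟦ repl c z φ ∨' (¬' atom p (var z ∷ [])) ⟧ M⁺ (v [ z ↦ a ])
    M⁺⊨ψ-at a with em {a ≡ conI M c}
    ... | yes refl = inj₁ (from (⟦repl⟧-at-con M⁺ c z φ z∉φ v) M⁺⊨φ)
    ... | no a≢c rewrite relI-⟨≔⟩-same M p (_≡ conI M c ∷ []) | update-same v z a =
      inj₂ λ { refl → a≢c refl }

    M⁺⊨ : ∀ χ → Δ χ → ⟦ χ ⟧ M⁺ v
    M⁺⊨ θ (inj₁ θ∈Θ)       = from (⟦⟧-⟨≔⟩-fresh M p _ θ (p∉Θ θ θ∈Θ) v) (M⊨ θ (inj₁ θ∈Θ))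
    M⁺⊨ _ (inj₂ (inj₁ refl)) rewrite relI-⟨≔⟩-same M p (_≡ conI M c ∷ []) = refl
    M⁺⊨ _ (inj₂ (inj₂ refl)) = M⁺⊨ψ-at

  model-without-witness-predicate : z ∉ vars φ →
    ∀ {A} → ModelOn A Δ → ModelOn A Γ
  model-without-witness-predicate z∉φ (M , v , M⊨) = M , v , M⊨′
    where
    M⊨′ : ∀ χ → Γ χ → ⟦ χ ⟧ M v
    M⊨′ θ (inj₁ θ∈Θ) = M⊨ θ (inj₁ θ∈Θ)
    M⊨′ _ (inj₂ refl) with M⊨ ψ (inj₂ (inj₂ refl)) (conI M c)
    ... | inj₁ φ′-at-c = to (⟦repl⟧-at-con M c z φ z∉φ v) φ′-at-c
    ... | inj₂ ¬p-at-c rewrite update-same v z (conI M c) = ⊥-elim (¬p-at-c (M⊨ _ (inj₂ (inj₁ refl))))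

lemma15 : ExcludedMiddle 0ℓ →
    (φ : Formula) (Θ : FormulaSet) (c p z : ℕ) →
    p ∉ preds φ → ((θ : Formula) → Θ θ → p ∉ preds θ) →
    z ∉ vars φ → ((θ : Formula) → Θ θ → z ∉ vars θ) →
    SameDomains (Θ ∪ ⁅ φ ⁆)
                (Θ ∪ ⁅ atom p (con c ∷ []) , all' z (repl c z φ ∨' (¬' atom p (var z ∷ []))) ⁆)
lemma15 em φ Θ c p z p∉φ p∉Θ z∉φ _ A =
  model-with-witness-predicate φ Θ c p z em p∉φ p∉Θ z∉φ ,′
  model-without-witness-predicate φ Θ c p z z∉φ
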